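{- Let $m\ge 1$ be an integer and let $G_m = P_m \times P_m$ be the $m\times m$ square grid graph. Then $G_m$ has a Hamiltonian cycle that is invariant under the $90^\circ$ rotation of the grid about its centre if and only if $m = 4k+2$ for some integer $k\ge 0$.
   Context: $P_m \times P_m$ is the graph with vertex set $\{1,\dots,m\}^2$, where two vertices are adjacent if and only if they differ by $1$ in exactly one coordinate. A Hamiltonian cycle is a cycle in the graph that visits every vertex exactly once. The cycle is regarded as its set of edges. The $90^\circ$ rotation about the centre is the map $(i,j)\mapsto (j,\, m+1-i)$. A cycle is invariant under this rotation if the rotation maps its edge set onto itself. -}

module Defs where

open import Data.Nat using (ℕ; zero; suc; _+_; _*_; _≤_)
open import Data.Fin using (Fin; toℕ; opposite)
import Data.Fin as Fin
open import Data.Product using (_×_; _,_; ∃-syntax)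
open import Data.Sum using (_⊎_)
open import Function.Definitions using (Bijective)
open import Relation.Binary.PropositionalEquality using (_≡_)

-- Vertices of P_m × P_m, with coordinates shifted to {0, …, m-1}.
Vertex : ℕ → Set
Vertex m = Fin m × Fin m

DiffOne : ℕ → ℕ → Set
DiffOne a b = (suc a ≡ b) ⊎ (suc b ≡ a)

Adj : (m : ℕ) → Vertex m → Vertex m → Set
Adj m (i , j) (i' , j') =
  (DiffOne (toℕ i) (toℕ i') × j ≡ j') ⊎ (i ≡ i' × DiffOne (toℕ j) (toℕ j'))

-- 90° rotation (i,j) ↦ (j, m+1-i) in 1-based coordinates,
-- i.e. (i,j) ↦ (j, m-1-i) in 0-based coordinates.
rot : (m : ℕ) → Vertex m → Vertex m
rot m (i , j) = (j , opposite i)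

-- Cyclic successor on Fin (suc n): k ↦ k+1, and the last index ↦ 0.
cyc : {n : ℕ} → Fin (suc n) → Fin (suc n)
cyc {zero} _ = Fin.zero
cyc {suc n} Fin.zero = Fin.suc Fin.zero
cyc {suc n} (Fin.suc k) with cyc {n} k
... | Fin.zero = Fin.zero
... | Fin.suc r = Fin.suc (Fin.suc r)

-- A Hamiltonian cycle of the m×m grid, given as a cyclic ordering
-- c 0, c 1, …, c (n-1) of all vertices (n = number of vertices):
-- c is a bijection onto the vertex set, consecutive vertices (including
-- c (n-1), c 0) are adjacent, and the cycle has at least 3 vertices.
record HamCycle (m : ℕ) : Set where
  field
    len      : ℕ
    order    : Fin (suc len) → Vertex m
    bij      : Bijective _≡_ _≡_ order
    adjacent : ∀ k → Adj m (order k) (order (cyc k))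
    atLeast3 : 2 ≤ len

  Edge : Vertex m → Vertex m → Set
  Edge u v = ∃[ k ] ((order k ≡ u × order (cyc k) ≡ v) ⊎ (order k ≡ v × order (cyc k) ≡ u))

open HamCycle public

RotInvariant : {m : ℕ} → HamCycle m → Set
RotInvariant {m} C =
  (∀ u v → Edge C u v → Edge C (rot m u) (rot m v)) ×
  (∀ u v → Edge C u v → ∃[ u' ] ∃[ v' ] (Edge C u' v' × rot m u' ≡ u × rot m v' ≡ v))

-- Colour the grid like a chessboard. A Hamiltonian cycle alternates colours, so its length m * m
-- is even and hence m is even; then the rotation swaps the colours, and its square, the point
-- reflection in the centre, fixes no vertex.
-- Number the vertices along the cycle. Invariance makes the rotation act on these numbers by a map
-- σ sending cycle edges to cycle edges, so σ either shifts every number by a common offset s or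
-- reverses the cycle. Reversal would make the point reflection fix a vertex. For a shift, s is odd
-- because the rotation swaps colours, and m * m ∣ 4 s because the rotation has order 4; together
-- these rule out 4 ∣ m, so m ≡ 2 (mod 4).
-- Conversely, for m = 2 n with n odd, a boustrophedon path through the top-left n × n quadrant
-- runs from (n - 1, 0) to (0, n - 1), and its four rotations join up into an invariant cycle.
module Submission where

open import Defs
open import Data.Empty using (⊥; ⊥-elim)
open import Data.Fin as Fin
  using (Fin; toℕ; fromℕ; opposite; combine; remQuot; splitAt; _↑ˡ_; _↑ʳ_)
open import Data.Fin.Patterns using (0F; 1F; 2F; 3F)
open import Data.Fin.Properties
  using ( toℕ-injective; toℕ<n; toℕ-fromℕ; toℕ-↑ˡ; toℕ-↑ʳ; ↑ˡ-injective
        ; splitAt-↑ˡ; splitAt-↑ʳ; splitAt⁻¹-↑ˡ; splitAt⁻¹-↑ʳ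
        ; toℕ-combine; combine-injective; combine-surjective; combine-remQuot; remQuot-combine
        ; opposite-prop; opposite-involutive
        ; cantor-schröder-bernstein; injective⇒≤; punchOut-injective; any?)
  renaming (_≟_ to _≟ᶠ_)
open import Data.Nat as ℕ using (ℕ; zero; suc; _+_; _*_; _∸_; _≤_; _<_; z≤n; s≤s; parity)
open import Data.Nat.Properties
open import Data.Nat.DivMod
  using (_%_; n%n≡0; m<n⇒m%n≡m; m%n%n≡m%n; %-distribˡ-+; m%n*o≡m*o%[n*o])
open import Data.Nat.Divisibility using (_∣_; divides; m%n≡0⇒n∣m)
open import Data.Nat.GeneralisedArithmetic using (fold)
open import Data.Nat.Tactic.RingSolver using (solve-∀)
open import Data.Parity.Base as ℙ using (Parity; 0ℙ; 1ℙ; _⁻¹)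
open import Data.Parity.Properties as ℙₚ
  using ( ⁻¹-involutive; ⁻¹-selfInverse; suc-homo-⁻¹; p≢p⁻¹; p+p≡0ℙ; p+p⁻¹≡1ℙ
        ; +-homo-+; *-homo-*; *-idem)
open import Data.Product using (Σ; _×_; _,_; proj₁; proj₂; ∃-syntax; uncurry)
open import Data.Sum as Sum using (_⊎_; inj₁; inj₂)
open import Function using (_⇔_; mk⇔; _∘_; _∘′_)
open import Function.Definitions using (Injective; Surjective; Bijective)
open import Relation.Nullary using (yes; no)
open import Relation.Binary.PropositionalEquality

-- The cycle on Fin (suc n)

cyc-view : ∀ {n} (x : Fin (suc n)) → (toℕ x ≡ n × cyc x ≡ 0F) ⊎ toℕ (cyc x) ≡ suc (toℕ x)
cyc-view {zero}  0F          = inj₁ (refl , refl)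
cyc-view {suc n} 0F          = inj₂ refl
cyc-view {suc n} (Fin.suc x) with cyc {n} x | cyc-view x
... | 0F        | inj₁ (x≡n , _) = inj₁ (cong suc x≡n , refl)
... | Fin.suc y | inj₂ y≡1+x     = inj₂ (cong suc y≡1+x)

toℕ-cyc : ∀ {n} (x : Fin (suc n)) → toℕ (cyc x) ≡ suc (toℕ x) % suc n
toℕ-cyc {n} x with cyc-view x
... | inj₁ (x≡n , cx≡0) rewrite cx≡0 | x≡n = sym (n%n≡0 (suc n))
... | inj₂ cx≡1+x =
  trans cx≡1+x (sym (m<n⇒m%n≡m (subst (_< suc n) cx≡1+x (toℕ<n (cyc x)))))

cyc-injective : ∀ {n} → Injective _≡_ _≡_ (cyc {n})
cyc-injective {x = x} {y} eq with cyc-view x | cyc-view y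
... | inj₁ (x≡n , _)  | inj₁ (y≡n , _)  = toℕ-injective (trans x≡n (sym y≡n))
... | inj₁ (_ , cx≡0) | inj₂ cy≡1+y
  with () ← trans (sym cy≡1+y) (cong toℕ (trans (sym eq) cx≡0))
... | inj₂ cx≡1+x     | inj₁ (_ , cy≡0)
  with () ← trans (sym cx≡1+x) (cong toℕ (trans eq cy≡0))
... | inj₂ cx≡1+x     | inj₂ cy≡1+y     =
  toℕ-injective (suc-injective (trans (sym cx≡1+x) (trans (cong toℕ eq) cy≡1+y)))

cyc²-no-fixed-point : ∀ {n} → 2 ≤ n → (x : Fin (suc n)) → cyc (cyc x) ≢ x
cyc²-no-fixed-point (s≤s (s≤s _)) x eq with cyc-view x
... | inj₁ (x≡n , cx≡0)
  with () ← trans (cong (toℕ ∘′ cyc) (sym cx≡0)) (trans (cong toℕ eq) x≡n)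
... | inj₂ cx≡1+x with cyc-view (cyc x)
...   | inj₁ (cx≡n , ccx≡0)
  with () ← trans (sym cx≡n) (trans cx≡1+x (cong (suc ∘′ toℕ) (trans (sym eq) ccx≡0)))
...   | inj₂ ccx≡1+cx = <⇒≢ (m<n⇒m<1+n (n<1+n (toℕ x)))
  (trans (sym (cong toℕ eq)) (trans ccx≡1+cx (cong suc cx≡1+x)))

fold-sucˡ : ∀ {A : Set} (z : A) (s : A → A) t → fold (s z) s t ≡ s (fold z s t)
fold-sucˡ z s zero    = refl
fold-sucˡ z s (suc t) = cong s (fold-sucˡ z s t)

fold-injective : ∀ {A : Set} {s : A → A} → Injective _≡_ _≡_ s →
                 ∀ t {x y} → fold x s t ≡ fold y s t → x ≡ y
fold-injective s-injective zero    eq = eq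
fold-injective s-injective (suc t) eq = fold-injective s-injective t (s-injective eq)

toℕ-fold-cyc : ∀ {n} t → toℕ (fold 0F (cyc {n}) t) ≡ t % suc n
toℕ-fold-cyc         zero    = refl
toℕ-fold-cyc {n = n} (suc t) = begin
  toℕ (cyc (fold 0F cyc t))     ≡⟨ toℕ-cyc (fold 0F cyc t) ⟩
  suc (toℕ (fold 0F cyc t)) % N ≡⟨ cong (λ r → suc r % N) (toℕ-fold-cyc t) ⟩
  (1 + t % N) % N               ≡⟨ %-distribˡ-+ 1 (t % N) N ⟩
  (1 % N + t % N % N) % N       ≡⟨ cong (λ r → (1 % N + r) % N) (m%n%n≡m%n t N) ⟩
  (1 % N + t % N) % N           ≡⟨ %-distribˡ-+ 1 t N ⟨
  suc t % N                     ∎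
  where open ≡-Reasoning; N = suc n

fold-cyc-toℕ : ∀ {n} (x : Fin (suc n)) → fold 0F cyc (toℕ x) ≡ x
fold-cyc-toℕ x = toℕ-injective (trans (toℕ-fold-cyc (toℕ x)) (m<n⇒m%n≡m (toℕ<n x)))

fold-cyc-period : ∀ {n} → fold 0F (cyc {n}) (suc n) ≡ 0F
fold-cyc-period {n} = toℕ-injective (trans (toℕ-fold-cyc (suc n)) (n%n≡0 (suc n)))

fold-cyc≡0⇒∣ : ∀ {n} t → fold 0F (cyc {n}) t ≡ 0F → suc n ∣ t
fold-cyc≡0⇒∣ {n} t eq = m%n≡0⇒n∣m t (suc n) (trans (sym (toℕ-fold-cyc t)) (cong toℕ eq))

cyc-induction : ∀ {n} (P : Fin (suc n) → Set) →
                P 0F → (∀ x → P x → P (cyc x)) → ∀ x → P x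
cyc-induction P P0 step x = subst P (fold-cyc-toℕ x) (along (toℕ x))
  where
  along : ∀ t → P (fold 0F cyc t)
  along zero    = P0
  along (suc t) = step _ (along t)

cyc-combine-step : ∀ {a b} (i : Fin (suc a)) {j : Fin (suc b)} →
                   toℕ (cyc j) ≡ suc (toℕ j) → cyc (combine i j) ≡ combine i (cyc j)
cyc-combine-step {a} {b} i {j} j-steps = toℕ-injective (begin
  toℕ (cyc (combine i j))           ≡⟨ toℕ-cyc (combine i j) ⟩
  suc (toℕ (combine i j)) % N       ≡⟨ cong (λ r → suc r % N) (toℕ-combine i j) ⟩
  suc (suc b * toℕ i + toℕ j) % N   ≡⟨ cong (_% N) (+-suc _ (toℕ j)) ⟨
  (suc b * toℕ i + suc (toℕ j)) % N ≡⟨ cong (λ r → (suc b * toℕ i + r) % N) j-steps ⟨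
  (suc b * toℕ i + toℕ (cyc j)) % N ≡⟨ cong (_% N) (toℕ-combine i (cyc j)) ⟨
  toℕ (combine i (cyc j)) % N       ≡⟨ m<n⇒m%n≡m (toℕ<n (combine i (cyc j))) ⟩
  toℕ (combine i (cyc j))           ∎)
  where open ≡-Reasoning; N = suc a * suc b

cyc-combine-wrap : ∀ {a b} (i : Fin (suc a)) {j : Fin (suc b)} →
                   toℕ j ≡ b → cyc (combine i j) ≡ combine (cyc i) 0F
cyc-combine-wrap {a} {b} i {j} j≡b = toℕ-injective (begin
  toℕ (cyc (combine i j))         ≡⟨ toℕ-cyc (combine i j) ⟩
  suc (toℕ (combine i j)) % N     ≡⟨ cong (λ r → suc r % N) (toℕ-combine i j) ⟩
  suc (suc b * toℕ i + toℕ j) % N ≡⟨ cong (λ r → suc (suc b * toℕ i + r) % N) j≡b ⟩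
  suc (suc b * toℕ i + b) % N     ≡⟨ cong (_% N) (carry (toℕ i) b) ⟩
  suc (toℕ i) * suc b % N         ≡⟨ m%n*o≡m*o%[n*o] (suc (toℕ i)) (suc a) (suc b) ⟨
  suc (toℕ i) % suc a * suc b     ≡⟨ cong (_* suc b) (toℕ-cyc i) ⟨
  toℕ (cyc i) * suc b             ≡⟨ *-comm (toℕ (cyc i)) (suc b) ⟩
  suc b * toℕ (cyc i)             ≡⟨ +-identityʳ _ ⟨
  suc b * toℕ (cyc i) + 0         ≡⟨ toℕ-combine (cyc i) 0F ⟨
  toℕ (combine (cyc i) 0F)        ∎)
  where
  open ≡-Reasoning
  N = suc a * suc b
  carry : ∀ x b → suc (suc b * x + b) ≡ suc x * suc b
  carry = solve-∀

module _ {n} {σ : Fin (suc n) → Fin (suc n)} where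

  Rotation Reflection : Set
  Rotation   = ∀ x → cyc (σ x) ≡ σ (cyc x)
  Reflection = ∀ x → cyc (σ (cyc x)) ≡ σ x

  -- With at least three vertices, σ cannot change orientation between consecutive edges.
  edge-preserving⇒rotation⊎reflection : 2 ≤ n → Injective _≡_ _≡_ σ →
    (∀ x → cyc (σ x) ≡ σ (cyc x) ⊎ cyc (σ (cyc x)) ≡ σ x) → Rotation ⊎ Reflection
  edge-preserving⇒rotation⊎reflection 2≤n σ-injective σ-edge with σ-edge 0F
  ... | inj₁ forward₀  = inj₁ (cyc-induction _ forward₀ forward-step)
    where
    forward-step : ∀ x → cyc (σ x) ≡ σ (cyc x) → cyc (σ (cyc x)) ≡ σ (cyc (cyc x))
    forward-step x forward with σ-edge (cyc x)
    ... | inj₁ forward′  = forward′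
    ... | inj₂ backward′ = ⊥-elim (cyc²-no-fixed-point 2≤n x
      (sym (σ-injective (cyc-injective (trans forward (sym backward′))))))
  ... | inj₂ backward₀ = inj₂ (cyc-induction _ backward₀ backward-step)
    where
    backward-step : ∀ x → cyc (σ (cyc x)) ≡ σ x → cyc (σ (cyc (cyc x))) ≡ σ (cyc x)
    backward-step x backward with σ-edge (cyc x)
    ... | inj₂ backward′ = backward′
    ... | inj₁ forward′  = ⊥-elim (cyc²-no-fixed-point 2≤n x
      (sym (σ-injective (trans (sym backward) forward′))))

  rotation-shifts : Rotation → ∀ t → σ (fold 0F cyc t) ≡ fold 0F cyc (t + toℕ (σ 0F))
  rotation-shifts rotation zero    = sym (fold-cyc-toℕ (σ 0F))
  rotation-shifts rotation (suc t) =
    trans (sym (rotation (fold 0F cyc t))) (cong cyc (rotation-shifts rotation t))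

  rotation-iterate : Rotation → ∀ j → fold 0F σ j ≡ fold 0F cyc (j * toℕ (σ 0F))
  rotation-iterate rotation zero    = refl
  rotation-iterate rotation (suc j) = begin
    σ (fold 0F σ j)          ≡⟨ cong σ (rotation-iterate rotation j) ⟩
    σ (fold 0F cyc (j * s))  ≡⟨ rotation-shifts rotation (j * s) ⟩
    fold 0F cyc (j * s + s)  ≡⟨ cong (fold 0F cyc) (+-comm (j * s) s) ⟩
    fold 0F cyc (suc j * s)  ∎
    where open ≡-Reasoning; s = toℕ (σ 0F)

  reflection-involutive₀ : Reflection → σ (σ 0F) ≡ 0F
  reflection-involutive₀ reflection = fold-injective cyc-injective s (begin
    fold (σ (σ 0F)) cyc s           ≡⟨ cong (λ x → fold (σ x) cyc s) (fold-cyc-toℕ (σ 0F)) ⟨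
    fold (σ (fold 0F cyc s)) cyc s  ≡⟨ mirror s ⟩
    σ 0F                            ≡⟨ fold-cyc-toℕ (σ 0F) ⟨
    fold 0F cyc s                   ∎)
    where
    open ≡-Reasoning
    s = toℕ (σ 0F)
    mirror : ∀ t → fold (σ (fold 0F cyc t)) cyc t ≡ σ 0F
    mirror zero    = refl
    mirror (suc t) = begin
      cyc (fold (σ (cyc y)) cyc t)  ≡⟨ fold-sucˡ _ cyc t ⟨
      fold (cyc (σ (cyc y))) cyc t  ≡⟨ cong (λ x → fold x cyc t) (reflection y) ⟩
      fold (σ y) cyc t              ≡⟨ mirror t ⟩
      σ 0F                          ∎
      where y = fold 0F cyc t

-- Colours, rotations and quadrants of the grid

⁻¹-distribˡ-+ : ∀ p q → (p ℙ.+ q) ⁻¹ ≡ p ⁻¹ ℙ.+ q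
⁻¹-distribˡ-+ 0ℙ q = refl
⁻¹-distribˡ-+ 1ℙ q = ⁻¹-involutive q

⁻¹-distribʳ-+ : ∀ p q → (p ℙ.+ q) ⁻¹ ≡ p ℙ.+ q ⁻¹
⁻¹-distribʳ-+ 0ℙ q = refl
⁻¹-distribʳ-+ 1ℙ q = refl

parity-suc : ∀ n → parity (suc n) ≡ parity n ⁻¹
parity-suc n = sym (⁻¹-selfInverse (suc-homo-⁻¹ n))

DiffOne-parity : ∀ {a b} → DiffOne a b → parity b ≡ parity a ⁻¹
DiffOne-parity {a}     (inj₁ refl) = parity-suc a
DiffOne-parity {b = b} (inj₂ refl) = sym (suc-homo-⁻¹ b)

colour : ∀ {m} → Vertex m → Parity
colour (i , j) = parity (toℕ i) ℙ.+ parity (toℕ j)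

Adj-colour : ∀ {m} {u v : Vertex m} → Adj m u v → colour v ≡ colour u ⁻¹
Adj-colour {u = i , j} (inj₁ (i~i′ , refl)) = trans
  (cong (ℙ._+ parity (toℕ j)) (DiffOne-parity i~i′)) (sym (⁻¹-distribˡ-+ (parity (toℕ i)) _))
Adj-colour {u = i , j} (inj₂ (refl , j~j′)) = trans
  (cong (parity (toℕ i) ℙ.+_) (DiffOne-parity j~j′)) (sym (⁻¹-distribʳ-+ (parity (toℕ i)) _))

opposite-sum : ∀ {m} (i : Fin m) → toℕ (opposite i) + suc (toℕ i) ≡ m
opposite-sum i = trans (cong (_+ suc (toℕ i)) (opposite-prop i)) (m∸n+n≡m (toℕ<n i))

opposite-injective : ∀ {m} → Injective _≡_ _≡_ (opposite {m})
opposite-injective {x = i} {j} eq =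
  trans (sym (opposite-involutive i)) (trans (cong opposite eq) (opposite-involutive j))

parity-opposite : ∀ {m} → parity m ≡ 0ℙ → (i : Fin m) →
                  parity (toℕ (opposite i)) ≡ parity (toℕ i) ⁻¹
parity-opposite {m} m-even i = trans (ℙₚ.+-cancelʳ-≡ p _ p (begin
  parity (toℕ (opposite i)) ℙ.+ p          ≡⟨ +-homo-+ (toℕ (opposite i)) (suc (toℕ i)) ⟨
  parity (toℕ (opposite i) + suc (toℕ i))  ≡⟨ cong parity (opposite-sum i) ⟩
  parity m                                 ≡⟨ m-even ⟩
  0ℙ                                       ≡⟨ p+p≡0ℙ p ⟨
  p ℙ.+ p                                  ∎)) (parity-suc (toℕ i))
  where open ≡-Reasoning; p = parity (suc (toℕ i))

opposite-no-fixed-point : ∀ {m} → parity m ≡ 0ℙ → (i : Fin m) → opposite i ≢ i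
opposite-no-fixed-point {m} m-even i opposite-i≡i = p≢p⁻¹ 1ℙ (begin
  1ℙ                                       ≡⟨ p+p⁻¹≡1ℙ (parity (toℕ i)) ⟨
  parity (toℕ i) ℙ.+ parity (toℕ i) ⁻¹     ≡⟨ cong (parity (toℕ i) ℙ.+_) (parity-suc (toℕ i)) ⟨
  parity (toℕ i) ℙ.+ parity (suc (toℕ i))  ≡⟨ +-homo-+ (toℕ i) (suc (toℕ i)) ⟨
  parity (toℕ i + suc (toℕ i))
    ≡⟨ cong (λ x → parity (toℕ x + suc (toℕ i))) opposite-i≡i ⟨
  parity (toℕ (opposite i) + suc (toℕ i))  ≡⟨ cong parity (opposite-sum i) ⟩
  parity m                                 ≡⟨ m-even ⟩
  0ℙ                                       ∎)
  where open ≡-Reasoning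

suc-opposite : ∀ {m} {i j : Fin m} →
               suc (toℕ i) ≡ toℕ j → suc (toℕ (opposite j)) ≡ toℕ (opposite i)
suc-opposite {i = i} {j} 1+i≡j = +-cancelʳ-≡ (toℕ j) _ _ (begin
  suc (toℕ (opposite j)) + toℕ j  ≡⟨ +-suc (toℕ (opposite j)) (toℕ j) ⟨
  toℕ (opposite j) + suc (toℕ j)  ≡⟨ trans (opposite-sum j) (sym (opposite-sum i)) ⟩
  toℕ (opposite i) + suc (toℕ i)  ≡⟨ cong (toℕ (opposite i) +_) 1+i≡j ⟩
  toℕ (opposite i) + toℕ j        ∎)
  where open ≡-Reasoning

DiffOne-opposite : ∀ {m} {i j : Fin m} →
                   DiffOne (toℕ i) (toℕ j) → DiffOne (toℕ (opposite i)) (toℕ (opposite j))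
DiffOne-opposite (inj₁ 1+i≡j) = inj₂ (suc-opposite 1+i≡j)
DiffOne-opposite (inj₂ 1+j≡i) = inj₁ (suc-opposite 1+j≡i)

DiffOne-↑ˡ : ∀ {m} n {i j : Fin m} →
             DiffOne (toℕ i) (toℕ j) → DiffOne (toℕ (i ↑ˡ n)) (toℕ (j ↑ˡ n))
DiffOne-↑ˡ n {i} {j} = subst₂ DiffOne (sym (toℕ-↑ˡ i n)) (sym (toℕ-↑ˡ j n))

rot-colour : ∀ {m} → parity m ≡ 0ℙ → (v : Vertex m) → colour (rot m v) ≡ colour v ⁻¹
rot-colour m-even (i , j) = begin
  pj ℙ.+ parity (toℕ (opposite i))  ≡⟨ cong (pj ℙ.+_) (parity-opposite m-even i) ⟩
  pj ℙ.+ pi ⁻¹                      ≡⟨ ⁻¹-distribʳ-+ pj pi ⟨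
  (pj ℙ.+ pi) ⁻¹                    ≡⟨ cong _⁻¹ (ℙₚ.+-comm pj pi) ⟩
  (pi ℙ.+ pj) ⁻¹                    ∎
  where open ≡-Reasoning; pi = parity (toℕ i); pj = parity (toℕ j)

rot-Adj : ∀ {m} {u v : Vertex m} → Adj m u v → Adj m (rot m u) (rot m v)
rot-Adj (inj₁ (i~i′ , j≡j′)) = inj₂ (j≡j′ , DiffOne-opposite i~i′)
rot-Adj (inj₂ (i≡i′ , j~j′)) = inj₁ (j~j′ , cong opposite i≡i′)

rot⁴≡id : ∀ {m} (v : Vertex m) → rot m (rot m (rot m (rot m v))) ≡ v
rot⁴≡id (i , j) = cong₂ _,_ (opposite-involutive i) (opposite-involutive j)

rot-injective : ∀ {m} → Injective _≡_ _≡_ (rot m)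
rot-injective {m} {u} {v} eq =
  trans (sym (rot⁴≡id u)) (trans (cong (λ w → rot m (rot m (rot m w))) eq) (rot⁴≡id v))

rot²-no-fixed-point : ∀ {m} → parity m ≡ 0ℙ → (v : Vertex m) → rot m (rot m v) ≢ v
rot²-no-fixed-point m-even (i , j) eq = opposite-no-fixed-point m-even i (cong proj₁ eq)

rotBy : ∀ {m} → Fin 4 → Vertex m → Vertex m
rotBy {m} q v = fold v (rot m) (toℕ q)

rotBy-cyc : ∀ {m} q (v : Vertex m) → rotBy (cyc q) v ≡ rot m (rotBy q v)
rotBy-cyc 0F v = refl
rotBy-cyc 1F v = refl
rotBy-cyc 2F v = refl
rotBy-cyc 3F v = sym (rot⁴≡id v)

rotBy-Adj : ∀ {m} q {u v : Vertex m} → Adj m u v → Adj m (rotBy q u) (rotBy q v)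
rotBy-Adj q = along (toℕ q)
  where
  along : ∀ {m} t {u v : Vertex m} → Adj m u v → Adj m (fold u (rot m) t) (fold v (rot m) t)
  along zero    u~v = u~v
  along (suc t) u~v = rot-Adj (along t u~v)

rotBy-injective : ∀ {m} q → Injective _≡_ _≡_ (rotBy {m} q)
rotBy-injective q = fold-injective rot-injective (toℕ q)

opposite-↑ˡ : ∀ n (i : Fin n) → opposite (i ↑ˡ n) ≡ n ↑ʳ opposite i
opposite-↑ˡ n i = toℕ-injective (begin
  toℕ (opposite (i ↑ˡ n))     ≡⟨ opposite-prop (i ↑ˡ n) ⟩
  n + n ∸ suc (toℕ (i ↑ˡ n))  ≡⟨ cong (λ x → n + n ∸ suc x) (toℕ-↑ˡ i n) ⟩
  n + n ∸ suc (toℕ i)         ≡⟨ +-∸-assoc n (toℕ<n i) ⟩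
  n + (n ∸ suc (toℕ i))       ≡⟨ cong (n +_) (opposite-prop i) ⟨
  n + toℕ (opposite i)        ≡⟨ toℕ-↑ʳ n (opposite i) ⟨
  toℕ (n ↑ʳ opposite i)       ∎)
  where open ≡-Reasoning

splitAt-opposite : ∀ n (i : Fin (n + n)) →
                   splitAt n (opposite i) ≡ Sum.swap (Sum.map opposite opposite (splitAt n i))
splitAt-opposite n i with splitAt n i in eq
... | inj₁ u = begin
  splitAt n (opposite i)         ≡⟨ cong (splitAt n ∘ opposite) (splitAt⁻¹-↑ˡ eq) ⟨
  splitAt n (opposite (u ↑ˡ n))  ≡⟨ cong (splitAt n) (opposite-↑ˡ n u) ⟩
  splitAt n (n ↑ʳ opposite u)    ≡⟨ splitAt-↑ʳ n n (opposite u) ⟩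
  inj₂ (opposite u)              ∎
  where open ≡-Reasoning
... | inj₂ u = begin
  splitAt n (opposite i)                     ≡⟨ cong (splitAt n ∘ opposite) (splitAt⁻¹-↑ʳ eq) ⟨
  splitAt n (opposite (n ↑ʳ u))              ≡⟨ cong (splitAt n ∘ opposite) u↑ʳ ⟩
  splitAt n (opposite (opposite (v ↑ˡ n)))   ≡⟨ cong (splitAt n) (opposite-involutive _) ⟩
  splitAt n (v ↑ˡ n)                         ≡⟨ splitAt-↑ˡ n v n ⟩
  inj₁ v                                     ∎
  where
  open ≡-Reasoning
  v = opposite u
  u↑ʳ : n ↑ʳ u ≡ opposite (v ↑ˡ n)
  u↑ʳ = trans (cong (n ↑ʳ_) (sym (opposite-involutive u))) (sym (opposite-↑ˡ n v))

quadrantOf : ∀ {n} → Fin n ⊎ Fin n → Fin n ⊎ Fin n → Fin 4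
quadrantOf (inj₁ _) (inj₁ _) = 0F
quadrantOf (inj₁ _) (inj₂ _) = 1F
quadrantOf (inj₂ _) (inj₂ _) = 2F
quadrantOf (inj₂ _) (inj₁ _) = 3F

quadrant : ∀ n → Vertex (n + n) → Fin 4
quadrant n (i , j) = quadrantOf (splitAt n i) (splitAt n j)

quadrant-rot : ∀ n (v : Vertex (n + n)) → quadrant n (rot (n + n) v) ≡ cyc (quadrant n v)
quadrant-rot n (i , j) rewrite splitAt-opposite n i with splitAt n i | splitAt n j
... | inj₁ _ | inj₁ _ = refl
... | inj₁ _ | inj₂ _ = refl
... | inj₂ _ | inj₂ _ = refl
... | inj₂ _ | inj₁ _ = refl

quadrant-rotBy : ∀ n q (v : Vertex (n + n)) →
                 quadrant n (rotBy q v) ≡ fold (quadrant n v) cyc (toℕ q)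
quadrant-rotBy n q v = along (toℕ q)
  where
  along : ∀ t → quadrant n (fold v (rot (n + n)) t) ≡ fold (quadrant n v) cyc t
  along zero    = refl
  along (suc t) = trans (quadrant-rot n _) (cong cyc (along t))

-- Hamiltonian cycles

encode : ∀ {m} → Vertex m → Fin (m * m)
encode = uncurry combine

encode-injective : ∀ {m} → Injective _≡_ _≡_ (encode {m})
encode-injective {x = i , j} {k , l} eq with combine-injective i j k l eq
... | refl , refl = refl

injective⇒surjective : ∀ {k n} → n ≤ k → (f : Fin k → Fin n) →
                       Injective _≡_ _≡_ f → Surjective _≡_ _≡_ f
injective⇒surjective {n = suc n} n≤k f f-injective y with any? (λ x → f x ≟ᶠ y)
... | yes (x , fx≡y) = x , λ { refl → fx≡y }
... | no ∄x = ⊥-elim (<-irrefl refl (≤-trans n≤k (injective⇒≤ g-injective)))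
  where
  y≢f : ∀ x → y ≢ f x
  y≢f x y≡fx = ∄x (x , sym y≡fx)
  g : Fin _ → Fin n
  g x = Fin.punchOut (y≢f x)
  g-injective : Injective _≡_ _≡_ g
  g-injective eq = f-injective (punchOut-injective (y≢f _) (y≢f _) eq)

injective⇒bijective : ∀ {m k} → m * m ≤ k → (f : Fin k → Vertex m) →
                      Injective _≡_ _≡_ f → Bijective _≡_ _≡_ f
injective⇒bijective m²≤k f f-injective = f-injective , surjective
  where
  surjective : Surjective _≡_ _≡_ f
  surjective v
    with x , fx≡v ← injective⇒surjective m²≤k (encode ∘ f) (f-injective ∘ encode-injective) (encode v)
    = x , λ { refl → encode-injective (fx≡v refl) }

rot-Edge⇒RotInvariant : ∀ {m} (C : HamCycle m) →
                        (∀ u v → Edge C u v → Edge C (rot m u) (rot m v)) → RotInvariant C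
rot-Edge⇒RotInvariant {m} C rot-Edge = rot-Edge , λ u v u~v →
  rot³ u , rot³ v , rot-Edge _ _ (rot-Edge _ _ (rot-Edge u v u~v)) , rot⁴≡id u , rot⁴≡id v
  where
  rot³ : Vertex m → Vertex m
  rot³ w = rot m (rot m (rot m w))

module _ {m} (C : HamCycle m) where

  index : Vertex m → Fin (suc (len C))
  index v = proj₁ (proj₂ (bij C) v)

  order-index : ∀ v → order C (index v) ≡ v
  order-index v = proj₂ (proj₂ (bij C) v) refl

  order-injective : Injective _≡_ _≡_ (order C)
  order-injective = proj₁ (bij C)

  HamCycle-size : suc (len C) ≡ m * m
  HamCycle-size = cantor-schröder-bernstein {f = encode ∘ order C} {g = index ∘ remQuot m}
    (order-injective ∘ encode-injective)
    (λ {x} {y} eq → begin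
      x                                       ≡⟨ combine-remQuot {m} m x ⟨
      encode (remQuot m x)                    ≡⟨ cong encode (order-index _) ⟨
      encode (order C (index (remQuot m x)))  ≡⟨ cong (encode ∘ order C) eq ⟩
      encode (order C (index (remQuot m y)))  ≡⟨ cong encode (order-index _) ⟩
      encode (remQuot m y)                    ≡⟨ combine-remQuot {m} m y ⟩
      y                                       ∎)
    where open ≡-Reasoning

  colour-along : ∀ t → colour (order C (fold 0F cyc t)) ≡ parity t ℙ.+ colour (order C 0F)
  colour-along zero    = refl
  colour-along (suc t) = begin
    colour (order C (cyc y))  ≡⟨ Adj-colour (adjacent C y) ⟩
    colour (order C y) ⁻¹     ≡⟨ cong _⁻¹ (colour-along t) ⟩
    (parity t ℙ.+ c) ⁻¹       ≡⟨ ⁻¹-distribˡ-+ (parity t) c ⟩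
    parity t ⁻¹ ℙ.+ c         ≡⟨ cong (ℙ._+ c) (parity-suc t) ⟨
    parity (suc t) ℙ.+ c      ∎
    where open ≡-Reasoning; y = fold 0F cyc t; c = colour (order C 0F)

  HamCycle-side-even : parity m ≡ 0ℙ
  HamCycle-side-even = begin
    parity m               ≡⟨ *-idem (parity m) ⟨
    parity m ℙ.* parity m  ≡⟨ *-homo-* m m ⟨
    parity (m * m)         ≡⟨ cong parity HamCycle-size ⟨
    parity (suc (len C))   ≡⟨ ℙₚ.+-cancelʳ-≡ c _ 0ℙ closed-walk ⟩
    0ℙ                     ∎
    where
    open ≡-Reasoning
    c = colour (order C 0F)
    closed-walk : parity (suc (len C)) ℙ.+ c ≡ c
    closed-walk = trans (sym (colour-along (suc (len C)))) (cong (colour ∘ order C) fold-cyc-period)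

-- Necessity

parity-split : ∀ n → ∃[ h ] (n ≡ 2 * h ⊎ n ≡ 1 + 2 * h)
parity-split zero = 0 , inj₁ refl
parity-split (suc n) with parity-split n
... | h , inj₁ refl = h , inj₂ refl
... | h , inj₂ refl = suc h , inj₁ (cong suc (sym (+-suc h (h + 0))))

parity-1+2* : ∀ h → parity (1 + 2 * h) ≡ 1ℙ
parity-1+2* h = trans (+-homo-+ 1 (2 * h)) (cong (1ℙ ℙ.+_) (*-homo-* 2 h))

[4p]²∣4s⇒s-even : ∀ p s → 4 * p * (4 * p) ∣ 4 * s → parity s ≡ 0ℙ
[4p]²∣4s⇒s-even p s (divides c 4s≡c[4p]²) = trans
  (cong parity (*-cancelˡ-≡ s (4 * (c * p * p)) 4 (trans 4s≡c[4p]² (sixteen c p))))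
  (*-homo-* 4 (c * p * p))
  where
  sixteen : ∀ c p → c * (4 * p * (4 * p)) ≡ 4 * (4 * (c * p * p))
  sixteen = solve-∀

m²∣4s⇒m≡4k+2 : ∀ m s → m * m ∣ 4 * s → parity s ≡ 1ℙ → parity m ≡ 0ℙ →
               ∃[ k ] m ≡ 4 * k + 2
m²∣4s⇒m≡4k+2 m s m²∣4s s-odd m-even with parity-split m
... | h , inj₂ refl with () ← trans (sym (parity-1+2* h)) m-even
... | h , inj₁ refl with parity-split h
...   | k , inj₂ refl = k , twice-odd k
  where
  twice-odd : ∀ k → 2 * (1 + 2 * k) ≡ 4 * k + 2
  twice-odd = solve-∀
...   | p , inj₁ refl = ⊥-elim (p≢p⁻¹ 0ℙ (trans (sym s-even) s-odd))
  where
  s-even : parity s ≡ 0ℙ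
  s-even = [4p]²∣4s⇒s-even p s (subst (λ x → x * x ∣ 4 * s) (sym (*-assoc 2 2 p)) m²∣4s)

module _ {m} (C : HamCycle m) (C-invariant : RotInvariant C) where
  private
    σ : Fin (suc (len C)) → Fin (suc (len C))
    σ x = index C (rot m (order C x))

    order-σ : ∀ x → order C (σ x) ≡ rot m (order C x)
    order-σ x = order-index C (rot m (order C x))

    ≡σ : ∀ {k x} → order C k ≡ rot m (order C x) → k ≡ σ x
    ≡σ {x = x} eq = order-injective C (trans eq (sym (order-σ x)))

    σ-injective : Injective _≡_ _≡_ σ
    σ-injective {x} {y} eq = order-injective C
      (rot-injective (trans (sym (order-σ x)) (trans (cong (order C) eq) (order-σ y))))

    σ-edge : ∀ x → cyc (σ x) ≡ σ (cyc x) ⊎ cyc (σ (cyc x)) ≡ σ x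
    σ-edge x with proj₁ C-invariant _ _ (x , inj₁ (refl , refl))
    ... | k , inj₁ (k↦x , ck↦cx) = inj₁ (trans (cong cyc (sym (≡σ k↦x))) (≡σ ck↦cx))
    ... | k , inj₂ (k↦cx , ck↦x) = inj₂ (trans (cong cyc (sym (≡σ k↦cx))) (≡σ ck↦x))

    offset : ℕ
    offset = toℕ (σ 0F)

    m-even : parity m ≡ 0ℙ
    m-even = HamCycle-side-even C

    reflection-impossible : Reflection {σ = σ} → ⊥
    reflection-impossible reflection = rot²-no-fixed-point m-even (order C 0F) (begin
      rot m (rot m (order C 0F))  ≡⟨ cong (rot m) (order-σ 0F) ⟨
      rot m (order C (σ 0F))      ≡⟨ order-σ (σ 0F) ⟨
      order C (σ (σ 0F))          ≡⟨ cong (order C) (reflection-involutive₀ reflection) ⟩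
      order C 0F                  ∎)
      where open ≡-Reasoning

    offset-odd : parity offset ≡ 1ℙ
    offset-odd = ℙₚ.+-cancelʳ-≡ c _ 1ℙ (begin
      parity offset ℙ.+ c                    ≡⟨ colour-along C offset ⟨
      colour (order C (fold 0F cyc offset))  ≡⟨ cong (colour ∘ order C) (fold-cyc-toℕ (σ 0F)) ⟩
      colour (order C (σ 0F))                ≡⟨ cong colour (order-σ 0F) ⟩
      colour (rot m (order C 0F))            ≡⟨ rot-colour m-even (order C 0F) ⟩
      c ⁻¹                                   ∎)
      where open ≡-Reasoning; c = colour (order C 0F)

    order-σ-iterate : ∀ j → order C (fold 0F σ j) ≡ fold (order C 0F) (rot m) j
    order-σ-iterate zero    = refl
    order-σ-iterate (suc j) = trans (order-σ _) (cong (rot m) (order-σ-iterate j))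

    rotation-period : Rotation {σ = σ} → suc (len C) ∣ 4 * offset
    rotation-period rotation = fold-cyc≡0⇒∣ (4 * offset) (begin
      fold 0F cyc (4 * offset)  ≡⟨ rotation-iterate rotation 4 ⟨
      fold 0F σ 4               ≡⟨ order-injective C (trans (order-σ-iterate 4) (rot⁴≡id _)) ⟩
      0F                        ∎)
      where open ≡-Reasoning

  RotInvariant⇒side≡4k+2 : ∃[ k ] m ≡ 4 * k + 2
  RotInvariant⇒side≡4k+2
    with edge-preserving⇒rotation⊎reflection (atLeast3 C) σ-injective σ-edge
  ... | inj₂ reflection = ⊥-elim (reflection-impossible reflection)
  ... | inj₁ rotation   = m²∣4s⇒m≡4k+2 m offset
    (subst (_∣ 4 * offset) (HamCycle-size C) (rotation-period rotation)) offset-odd m-even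

-- The snake cycle

module _ (K : ℕ) (K-even : parity K ≡ 0ℙ) where
  private
    n : ℕ
    n = suc K

    last : Fin n
    last = fromℕ K

  boustrophedon : Parity → Fin n → Fin n
  boustrophedon 0ℙ b = b
  boustrophedon 1ℙ b = opposite b

  -- Row a of the path is grid row n - 1 - a, run left to right for even a; as n is odd, the path
  -- ends at (0, n - 1), next to rot (snake 0 0) = (0, n).
  snake : Fin n → Fin n → Vertex (n + n)
  snake a b = opposite a ↑ˡ n , boustrophedon (parity (toℕ a)) b ↑ˡ n

  boustrophedon-DiffOne : ∀ p {b b′} → DiffOne (toℕ b) (toℕ b′) →
                          DiffOne (toℕ (boustrophedon p b)) (toℕ (boustrophedon p b′))
  boustrophedon-DiffOne 0ℙ b~b′ = b~b′
  boustrophedon-DiffOne 1ℙ b~b′ = DiffOne-opposite b~b′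

  boustrophedon-turn : ∀ p → boustrophedon p last ≡ boustrophedon (p ⁻¹) 0F
  boustrophedon-turn 0ℙ = refl
  boustrophedon-turn 1ℙ = opposite-involutive 0F

  boustrophedon-injective : ∀ p → Injective _≡_ _≡_ (boustrophedon p)
  boustrophedon-injective 0ℙ eq = eq
  boustrophedon-injective 1ℙ    = opposite-injective

  snake-injective : ∀ {a b a′ b′} → snake a b ≡ snake a′ b′ → a ≡ a′ × b ≡ b′
  snake-injective {a} {b} {a′} {b′} eq
    with refl ← opposite-injective {x = a} {a′} (↑ˡ-injective n _ _ (cong proj₁ eq))
    = refl , boustrophedon-injective (parity (toℕ a)) (↑ˡ-injective n _ _ (cong proj₂ eq))

  snake-along-row : ∀ a {b b′} → toℕ b′ ≡ suc (toℕ b) →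
                    Adj (n + n) (snake a b) (snake a b′)
  snake-along-row a b′≡1+b =
    inj₂ (refl , DiffOne-↑ˡ n (boustrophedon-DiffOne (parity (toℕ a)) (inj₁ (sym b′≡1+b))))

  snake-next-row : ∀ {a a′} → toℕ a′ ≡ suc (toℕ a) →
                   Adj (n + n) (snake a last) (snake a′ 0F)
  snake-next-row {a} {a′} a′≡1+a =
    inj₁ (DiffOne-↑ˡ n (DiffOne-opposite (inj₁ (sym a′≡1+a))) , cong (_↑ˡ n) (begin
      boustrophedon (parity (toℕ a)) last        ≡⟨ boustrophedon-turn (parity (toℕ a)) ⟩
      boustrophedon (parity (toℕ a) ⁻¹) 0F       ≡⟨ cong (λ p → boustrophedon p 0F) parity-a′ ⟨
      boustrophedon (parity (toℕ a′)) 0F         ∎))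
    where
    open ≡-Reasoning
    parity-a′ : parity (toℕ a′) ≡ parity (toℕ a) ⁻¹
    parity-a′ = trans (cong parity a′≡1+a) (parity-suc (toℕ a))

  snake-corner : Adj (n + n) (snake last last) (rot (n + n) (snake 0F 0F))
  snake-corner = inj₂ (cong (_↑ˡ n) (opposite-involutive 0F) , inj₁ (begin
    suc (toℕ (boustrophedon (parity (toℕ last)) last ↑ˡ n))
      ≡⟨ cong (λ p → suc (toℕ (boustrophedon p last ↑ˡ n))) last-even ⟩
    suc (toℕ (last ↑ˡ n))       ≡⟨ cong suc (toℕ-↑ˡ last n) ⟩
    suc (toℕ last)              ≡⟨ cong suc (toℕ-fromℕ K) ⟩
    n                           ≡⟨ +-identityʳ n ⟨
    n + 0                       ≡⟨ cong (λ x → n + toℕ x) (opposite-involutive 0F) ⟨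
    n + toℕ (opposite last)     ≡⟨ toℕ-↑ʳ n (opposite last) ⟨
    toℕ (n ↑ʳ opposite last)    ≡⟨ cong toℕ (opposite-↑ˡ n last) ⟨
    toℕ (opposite (last ↑ˡ n))  ∎))
    where
    open ≡-Reasoning
    last-even : parity (toℕ last) ≡ 0ℙ
    last-even = trans (cong parity (toℕ-fromℕ K)) K-even

  snakeAt : Fin (n * n) → Vertex (n + n)
  snakeAt r = uncurry snake (remQuot {n} n r)

  snakeAt-combine : ∀ a b → snakeAt (combine a b) ≡ snake a b
  snakeAt-combine a b = cong (uncurry snake) (remQuot-combine a b)

  snakeAt-last : ∀ {r} → toℕ r ≡ K + K * n → snakeAt r ≡ snake last last
  snakeAt-last {r} r≡last = trans (cong snakeAt r≡combine) (snakeAt-combine last last)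
    where
    r≡combine : r ≡ combine last last
    r≡combine = toℕ-injective (begin
      toℕ r                    ≡⟨ r≡last ⟩
      K + K * n                ≡⟨ +-comm K (K * n) ⟩
      K * n + K                ≡⟨ cong (_+ K) (*-comm K n) ⟩
      n * K + K                ≡⟨ cong₂ (λ x y → n * x + y) (toℕ-fromℕ K) (toℕ-fromℕ K) ⟨
      n * toℕ last + toℕ last  ≡⟨ toℕ-combine last last ⟨
      toℕ (combine last last)  ∎)
      where open ≡-Reasoning

  snakeAt-injective : Injective _≡_ _≡_ snakeAt
  snakeAt-injective {r} {r′} eq
    with a , b , refl ← combine-surjective {n} {n} r
       | a′ , b′ , refl ← combine-surjective {n} {n} r′
    with refl , refl ← snake-injective {a} {b} {a′} {b′}
                         (trans (sym (snakeAt-combine a b)) (trans eq (snakeAt-combine a′ b′)))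
    = refl

  snakeAt-Adj : ∀ a b a′ b′ {r′} → r′ ≡ combine a′ b′ →
                Adj (n + n) (snake a b) (snake a′ b′) →
                Adj (n + n) (snakeAt (combine a b)) (snakeAt r′)
  snakeAt-Adj a b a′ b′ refl =
    subst₂ (Adj (n + n)) (sym (snakeAt-combine a b)) (sym (snakeAt-combine a′ b′))

  snake-path : ∀ r → toℕ (cyc r) ≡ suc (toℕ r) → Adj (n + n) (snakeAt r) (snakeAt (cyc r))
  snake-path r r-steps with a , b , refl ← combine-surjective {n} {n} r with cyc-view b
  ... | inj₂ b-steps =
    snakeAt-Adj a b a (cyc b) (cyc-combine-step a b-steps) (snake-along-row a b-steps)
  ... | inj₁ (b≡K , _) with cyc-view a
  ...   | inj₂ a-steps with refl ← toℕ-injective {i = b} {last} (trans b≡K (sym (toℕ-fromℕ K)))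
    = snakeAt-Adj a last (cyc a) 0F (cyc-combine-wrap a b≡K) (snake-next-row a-steps)
  ...   | inj₁ (_ , ca≡0) with () ← trans (sym r-steps)
    (cong toℕ (trans (cyc-combine-wrap a b≡K) (cong (λ c → combine c 0F) ca≡0)))

  quadrant-snake : ∀ a b → quadrant n (snake a b) ≡ 0F
  quadrant-snake a b rewrite splitAt-↑ˡ n (opposite a) n
                           | splitAt-↑ˡ n (boustrophedon (parity (toℕ a)) b) n
    = refl

  quadrant-snakeAt : ∀ r → quadrant n (snakeAt r) ≡ 0F
  quadrant-snakeAt r = quadrant-snake (proj₁ (remQuot {n} n r)) (proj₂ (remQuot {n} n r))

  rotBy-corner : ∀ q → Adj (n + n) (rotBy q (snake last last)) (rotBy (cyc q) (snake 0F 0F))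
  rotBy-corner q = subst (Adj (n + n) (rotBy q (snake last last)))
    (trans (fold-sucˡ (snake 0F 0F) (rot (n + n)) (toℕ q)) (sym (rotBy-cyc q (snake 0F 0F))))
    (rotBy-Adj q snake-corner)

  tour : Fin (4 * (n * n)) → Vertex (n + n)
  tour x = uncurry (λ q r → rotBy q (snakeAt r)) (remQuot {4} (n * n) x)

  tour-combine : ∀ q r → tour (combine q r) ≡ rotBy q (snakeAt r)
  tour-combine q r = cong (uncurry (λ q r → rotBy q (snakeAt r))) (remQuot-combine q r)

  tour-Adj : ∀ q r q′ r′ {x′} → x′ ≡ combine q′ r′ →
             Adj (n + n) (rotBy q (snakeAt r)) (rotBy q′ (snakeAt r′)) →
             Adj (n + n) (tour (combine q r)) (tour x′)
  tour-Adj q r q′ r′ refl =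
    subst₂ (Adj (n + n)) (sym (tour-combine q r)) (sym (tour-combine q′ r′))

  tour-adjacent : ∀ x → Adj (n + n) (tour x) (tour (cyc x))
  tour-adjacent x with q , r , refl ← combine-surjective {4} {n * n} x with cyc-view r
  ... | inj₂ r-steps = tour-Adj q r q (cyc r) (cyc-combine-step q r-steps)
    (rotBy-Adj q (snake-path r r-steps))
  ... | inj₁ (r≡last , _) = tour-Adj q r (cyc q) 0F (cyc-combine-wrap q r≡last)
    (subst (λ v → Adj (n + n) (rotBy q v) _) (sym (snakeAt-last r≡last)) (rotBy-corner q))

  quadrant-tour : ∀ q r → quadrant n (tour (combine q r)) ≡ q
  quadrant-tour q r = begin
    quadrant n (tour (combine q r))            ≡⟨ cong (quadrant n) (tour-combine q r) ⟩
    quadrant n (rotBy q (snakeAt r))           ≡⟨ quadrant-rotBy n q (snakeAt r) ⟩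
    fold (quadrant n (snakeAt r)) cyc (toℕ q)  ≡⟨ cong (λ c → fold c cyc (toℕ q)) (quadrant-snakeAt r) ⟩
    fold 0F cyc (toℕ q)                        ≡⟨ fold-cyc-toℕ q ⟩
    q                                          ∎
    where open ≡-Reasoning

  tour-injective : Injective _≡_ _≡_ tour
  tour-injective {x} {y} eq
    with q , r , refl ← combine-surjective {4} {n * n} x
       | q′ , r′ , refl ← combine-surjective {4} {n * n} y
    with refl ← trans (sym (quadrant-tour q r)) (trans (cong (quadrant n) eq) (quadrant-tour q′ r′))
    with refl ← snakeAt-injective {r} {r′}
                  (rotBy-injective q (trans (sym (tour-combine q r)) (trans eq (tour-combine q r′))))
    = refl

  turn : Fin (4 * (n * n)) → Fin (4 * (n * n))
  turn x = uncurry (λ q r → combine (cyc q) r) (remQuot {4} (n * n) x)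

  turn-combine : ∀ (q : Fin 4) (r : Fin (n * n)) → turn (combine q r) ≡ combine (cyc q) r
  turn-combine q r = cong (uncurry (λ q r → combine (cyc q) r)) (remQuot-combine q r)

  tour-turn : ∀ x → tour (turn x) ≡ rot (n + n) (tour x)
  tour-turn x with q , r , refl ← combine-surjective {4} {n * n} x = begin
    tour (turn (combine q r))          ≡⟨ cong tour (turn-combine q r) ⟩
    tour (combine (cyc q) r)           ≡⟨ tour-combine (cyc q) r ⟩
    rotBy (cyc q) (snakeAt r)          ≡⟨ rotBy-cyc q (snakeAt r) ⟩
    rot (n + n) (rotBy q (snakeAt r))  ≡⟨ cong (rot (n + n)) (tour-combine q r) ⟨
    rot (n + n) (tour (combine q r))   ∎
    where open ≡-Reasoning

  turn-cyc : ∀ x → cyc (turn x) ≡ turn (cyc x)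
  turn-cyc x with q , r , refl ← combine-surjective {4} {n * n} x with cyc-view r
  ... | inj₂ r-steps = begin
    cyc (turn (combine q r))  ≡⟨ cong cyc (turn-combine q r) ⟩
    cyc (combine (cyc q) r)   ≡⟨ cyc-combine-step (cyc q) r-steps ⟩
    combine (cyc q) (cyc r)   ≡⟨ turn-combine q (cyc r) ⟨
    turn (combine q (cyc r))  ≡⟨ cong turn (cyc-combine-step q r-steps) ⟨
    turn (cyc (combine q r))  ∎
    where open ≡-Reasoning
  ... | inj₁ (r≡last , _) = begin
    cyc (turn (combine q r))   ≡⟨ cong cyc (turn-combine q r) ⟩
    cyc (combine (cyc q) r)    ≡⟨ cyc-combine-wrap (cyc q) r≡last ⟩
    combine (cyc (cyc q)) 0F   ≡⟨ turn-combine (cyc q) 0F ⟨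
    turn (combine (cyc q) 0F)  ≡⟨ cong turn (cyc-combine-wrap q r≡last) ⟨
    turn (cyc (combine q r))   ∎
    where open ≡-Reasoning

  snake-cycle : HamCycle (n + n)
  snake-cycle = record
    { len      = ℕ.pred (4 * (n * n))
    ; order    = tour
    ; bij      = injective⇒bijective (≤-reflexive (side² n)) tour tour-injective
    ; adjacent = tour-adjacent
    ; atLeast3 = ≤-trans (n≤1+n 2) (ℕ.s≤s⁻¹ (*-monoʳ-≤ 4 (s≤s z≤n)))
    }
    where
    side² : ∀ n → (n + n) * (n + n) ≡ 4 * (n * n)
    side² = solve-∀

  snake-cycle-invariant : RotInvariant snake-cycle
  snake-cycle-invariant = rot-Edge⇒RotInvariant snake-cycle λ u v (k , k-edge) →
    turn k , Sum.map (turned k) (turned k) k-edge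
    where
    turned : ∀ k {u v} → tour k ≡ u × tour (cyc k) ≡ v →
             tour (turn k) ≡ rot (n + n) u × tour (cyc (turn k)) ≡ rot (n + n) v
    turned k (refl , refl) = tour-turn k , trans (cong tour (turn-cyc k)) (tour-turn (cyc k))

side≡4k+2⇒RotInvariant : ∀ k → Σ (HamCycle (4 * k + 2)) RotInvariant
side≡4k+2⇒RotInvariant k = subst (λ m → Σ (HamCycle m) RotInvariant) (side k)
  (snake-cycle (k + k) k+k-even , snake-cycle-invariant (k + k) k+k-even)
  where
  k+k-even : parity (k + k) ≡ 0ℙ
  k+k-even = trans (+-homo-+ k k) (p+p≡0ℙ (parity k))
  side : ∀ k → suc (k + k) + suc (k + k) ≡ 4 * k + 2
  side = solve-∀

mainTheorem1 : (m : ℕ) → 1 ≤ m →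
    (Σ (HamCycle m) RotInvariant) ⇔ (∃[ k ] m ≡ 4 * k + 2)
mainTheorem1 m _ = mk⇔
  (λ (C , C-invariant) → RotInvariant⇒side≡4k+2 C C-invariant)
  (λ (k , m≡4k+2) →
    subst (λ m → Σ (HamCycle m) RotInvariant) (sym m≡4k+2) (side≡4k+2⇒RotInvariant k))
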